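{- Let $A$ be a forest automaton. For every infinite execution $\alpha$ of $A$ let $\mathit{pair}(\alpha)=\langle\mathit{states}(\alpha),\emptyset\rangle$, where $\mathit{states}(\alpha)$ is the set of states occurring in $\alpha$. Then for all $\alpha,\alpha'\in\mathit{execs}^\omega(A)$: $\alpha'\neq\alpha$ if and only if $\alpha'\models\mathit{pair}(\alpha)$.
   Context: An automaton $A$ has states, nonempty start states, actions, and transitions. An execution is a finite or infinite alternating sequence $s_0a_1s_1\ldots$ starting in a start state and following transitions (ending in a state if finite); $\mathit{execs}^\omega(A)$ is the set of infinite executions; a state is reachable if it occurs in some execution. $A$ is a forest automaton if for each reachable state $s$ there is exactly one finite execution of $A$ with last state $s$. For a pair $\langle R,G\rangle$ of sets of states and an infinite execution $\alpha'$, $\alpha'\models\langle R,G\rangle$ iff: if infinitely many positions of $\alpha'$ carry states in $R$, then infinitely many positions carry states in $G$. -}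

module Defs where

open import Data.Nat using (ℕ; zero; suc; _≤_; _<_)
open import Data.Product using (Σ; ∃; _×_; _,_)
open import Data.Sum using (_⊎_)
open import Data.Empty using (⊥)
open import Relation.Nullary using (¬_)
open import Relation.Binary.PropositionalEquality using (_≡_)

record Automaton : Set₁ where
  field
    State      : Set
    Action     : Set
    start      : State → Set
    start-ne   : ∃ λ s → start s
    trans      : State → Action → State → Set

module _ (A : Automaton) where
  open Automaton A

  -- A finite execution s₀ a₁ s₁ … a_len s_len, encoded by sequences on ℕ
  -- of which only the positions ≤ len (states) / < len (actions) matter.
  -- act i is the action a_{i+1} between st i and st (suc i).
  record FinExec : Set where
    field
      len   : ℕ
      st    : ℕ → State
      act   : ℕ → Action
      first : start (st 0)
      steps : ∀ i → i < len → trans (st i) (act i) (st (suc i))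

  lastState : FinExec → State
  lastState e = FinExec.st e (FinExec.len e)

  FinExecEq : FinExec → FinExec → Set
  FinExecEq e e' =
    (FinExec.len e ≡ FinExec.len e')
    × (∀ i → i ≤ FinExec.len e → FinExec.st e i ≡ FinExec.st e' i)
    × (∀ i → i < FinExec.len e → FinExec.act e i ≡ FinExec.act e' i)

  record InfExec : Set where
    field
      st    : ℕ → State
      act   : ℕ → Action
      first : start (st 0)
      steps : ∀ i → trans (st i) (act i) (st (suc i))

  InfExecEq : InfExec → InfExec → Set
  InfExecEq α β =
    (∀ i → InfExec.st α i ≡ InfExec.st β i)
    × (∀ i → InfExec.act α i ≡ InfExec.act β i)

  Reachable : State → Set
  Reachable s =
    (Σ FinExec λ e → ∃ λ i → i ≤ FinExec.len e × FinExec.st e i ≡ s)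
    ⊎ (Σ InfExec λ α → ∃ λ i → InfExec.st α i ≡ s)

  IsForest : Set
  IsForest = ∀ s → Reachable s →
    (Σ FinExec λ e → lastState e ≡ s)
    × (∀ e e' → lastState e ≡ s → lastState e' ≡ s → FinExecEq e e')

  states : InfExec → State → Set
  states α s = ∃ λ i → InfExec.st α i ≡ s

  InfOften : InfExec → (State → Set) → Set
  InfOften α P = ∀ n → ∃ λ m → n ≤ m × P (InfExec.st α m)

  _⊨⟨_,_⟩ : InfExec → (State → Set) → (State → Set) → Set
  α ⊨⟨ R , G ⟩ = InfOften α R → InfOften α G

  ∅ : State → Set
  ∅ _ = ⊥

  _⊨pair_ : InfExec → InfExec → Set
  α' ⊨pair α = α' ⊨⟨ states α , ∅ ⟩

-- In a forest automaton a reachable state determines the whole finite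
-- execution leading to it.  If α' visits states of α at arbitrarily late
-- positions m, then each prefix of α' of length m is also a prefix of α, so
-- α' = α.  Hence for α' ≠ α the premise of α' ⊨ ⟨states(α), ∅⟩ fails, while
-- for α' = α it holds and the conclusion (∅ infinitely often) is false.
module Submission where

open import Defs
open import Data.Empty using (⊥-elim)
open import Data.Nat using (ℕ; suc; _<_)
open import Data.Nat.Properties using (≤-refl; <⇒≤)
open import Data.Product using (∃; _×_; _,_; proj₂)
open import Data.Sum using (inj₂)
open import Function.Bundles using (_⇔_; mk⇔)
open import Relation.Binary.PropositionalEquality using (_≡_; refl; sym)
open import Relation.Nullary using (¬_)

module _ (A : Automaton) where
  open Automaton A

  prefix : InfExec A → ℕ → FinExec A
  prefix α m = record
    { len = m ; st = InfExec.st α ; act = InfExec.act α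
    ; first = InfExec.first α ; steps = λ i _ → InfExec.steps α i }

  ¬InfOften-∅ : (α : InfExec A) → ¬ InfOften A α (∅ A)
  ¬InfOften-∅ α io with io 0
  ... | _ , _ , ()

  InfExecEq⇒InfOften-states : (α α' : InfExec A) →
    InfExecEq A α' α → InfOften A α' (states A α)
  InfExecEq⇒InfOften-states α α' (st≡ , _) n = n , ≤-refl , n , sym (st≡ n)

  module _ (forest : IsForest A) where

    prefix-unique : (α α' : InfExec A) (m i : ℕ) →
      InfExec.st α i ≡ InfExec.st α' m → FinExecEq A (prefix α' m) (prefix α i)
    prefix-unique α α' m i st≡ =
      proj₂ (forest (InfExec.st α' m) (inj₂ (α' , m , refl)))
        (prefix α' m) (prefix α i) refl st≡

    InfOften-states⇒InfExecEq : (α α' : InfExec A) →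
      InfOften A α' (states A α) → InfExecEq A α' α
    InfOften-states⇒InfExecEq α α' io = st≡ , act≡
      where
      shared-prefix : ∀ j → ∃ λ m → ∃ λ i → j < m × FinExecEq A (prefix α' m) (prefix α i)
      shared-prefix j with io (suc j)
      ... | m , j<m , i , st≡ₘ = m , i , j<m , prefix-unique α α' m i st≡ₘ

      st≡ : ∀ j → InfExec.st α' j ≡ InfExec.st α j
      st≡ j with shared-prefix j
      ... | _ , _ , j<m , (_ , st≡ₚ , _) = st≡ₚ j (<⇒≤ j<m)

      act≡ : ∀ j → InfExec.act α' j ≡ InfExec.act α j
      act≡ j with shared-prefix j
      ... | _ , _ , j<m , (_ , _ , act≡ₚ) = act≡ₚ j j<m

proposition16 : (A : Automaton) → IsForest A →
    (α α' : InfExec A) → (¬ InfExecEq A α' α) ⇔ _⊨pair_ A α' α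
proposition16 A forest α α' = mk⇔ to from
  where
  to : ¬ InfExecEq A α' α → _⊨pair_ A α' α
  to α'≠α io = ⊥-elim (α'≠α (InfOften-states⇒InfExecEq A forest α α' io))

  from : _⊨pair_ A α' α → ¬ InfExecEq A α' α
  from ⊨ α'≡α = ¬InfOften-∅ A α' (⊨ (InfExecEq⇒InfOften-states A α α' α'≡α))
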